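{- Let $\mathsf{K}$ be the variety of algebras $\langle A,\wedge,\vee,\neg,J_2,0,1\rangle$ axiomatised by the identities (K1)–(K12) below. Then $\mathsf{K}$ satisfies: (1) $x\vee J_2x\approx x$; (2) $x\approx J_2x\vee(x\wedge\neg x)$; (3) $J_2J_2x\approx J_2x$; (4) $x\vee\neg J_2y\approx x\vee\neg J_2(x\vee y)$.
   Context: Axioms of $\mathsf{K}$: (K1) $x\vee x\approx x$; (K2) $x\vee y\approx y\vee x$; (K3) $x\vee(y\vee z)\approx(x\vee y)\vee z$; (K4) $\neg\neg x\approx x$; (K5) $x\wedge y\approx\neg(\neg x\vee\neg y)$; (K6) $x\wedge(\neg x\vee y)\approx x\wedge y$; (K7) $0\vee x\approx x$; (K8) $1\approx\neg0$; (K9) $J_2x\vee\neg J_2x\approx1$; (K10) $x\vee J_2y\approx x\vee J_2(x\vee y)$; (K11) $x\wedge J_2x\approx x$; (K12) $J_2(x\wedge\neg x)\approx0$. -}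

module Defs where

open import Level using (Level; suc)
open import Relation.Binary.PropositionalEquality using (_≡_)

record KAlgebra (a : Level) : Set (suc a) where
  infixr 6 _∨_
  infixr 7 _∧_
  field
    Carrier : Set a
    _∧_ _∨_ : Carrier → Carrier → Carrier
    ¬_ J₂ : Carrier → Carrier
    𝟎 𝟏 : Carrier
    K1  : ∀ x → x ∨ x ≡ x
    K2  : ∀ x y → x ∨ y ≡ y ∨ x
    K3  : ∀ x y z → x ∨ (y ∨ z) ≡ (x ∨ y) ∨ z
    K4  : ∀ x → ¬ (¬ x) ≡ x
    K5  : ∀ x y → x ∧ y ≡ ¬ (¬ x ∨ ¬ y)
    K6  : ∀ x y → x ∧ (¬ x ∨ y) ≡ x ∧ y
    K7  : ∀ x → 𝟎 ∨ x ≡ x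
    K8  : 𝟏 ≡ ¬ 𝟎
    K9  : ∀ x → J₂ x ∨ ¬ (J₂ x) ≡ 𝟏
    K10 : ∀ x y → x ∨ J₂ y ≡ x ∨ J₂ (x ∨ y)
    K11 : ∀ x → x ∧ J₂ x ≡ x
    K12 : ∀ x → J₂ (x ∧ ¬ x) ≡ 𝟎

-- ¬ is an involution exchanging ∨ and ∧, so (K6) has the dual form
-- x ∨ ¬ (x ∨ y) ≡ x ∨ ¬ y, and by (K9) every J₂ x is complemented. Identity (1)
-- comes from (K12) and (K10) via x ∨ (x ∧ ¬ x) ≡ x, and (4) from (K10) inside
-- the dual of (K6). For (2), the dual of (K6) turns x ≡ J₂ x ∨ x into
-- J₂ x ∨ (¬ J₂ x ∧ x), and since x lies below J₂ x by (K11) the second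
-- disjunct collapses to x ∧ 𝟎 ≡ x ∧ ¬ x. For (3), ¬ J₂ (J₂ x) ∨ J₂ x ≡ 𝟏
-- puts J₂ (J₂ x) below J₂ x, and (K11) gives the other direction.
module Submission where

open import Defs
open import Level using (Level)
open import Data.Product using (_×_; _,_)
open import Relation.Binary.PropositionalEquality using (_≡_; sym; trans; cong; cong₂)
open Relation.Binary.PropositionalEquality.≡-Reasoning

module KAlgebraProperties {a : Level} (A : KAlgebra a) where
  open KAlgebra A

  ∨-identityʳ : ∀ x → x ∨ 𝟎 ≡ x
  ∨-identityʳ x = trans (K2 x 𝟎) (K7 x)

  ¬𝟏≡𝟎 : ¬ 𝟏 ≡ 𝟎
  ¬𝟏≡𝟎 = trans (cong ¬_ K8) (K4 𝟎)

  ¬-∧ : ∀ x y → ¬ (x ∧ y) ≡ ¬ x ∨ ¬ y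
  ¬-∧ x y = trans (cong ¬_ (K5 x y)) (K4 _)

  ¬-∨ : ∀ x y → ¬ (x ∨ y) ≡ ¬ x ∧ ¬ y
  ¬-∨ x y = sym (trans (K5 (¬ x) (¬ y)) (cong ¬_ (cong₂ _∨_ (K4 x) (K4 y))))

  ∧-comm : ∀ x y → x ∧ y ≡ y ∧ x
  ∧-comm x y = trans (K5 x y) (trans (cong ¬_ (K2 (¬ x) (¬ y))) (sym (K5 y x)))

  ∧-assoc : ∀ x y z → x ∧ (y ∧ z) ≡ (x ∧ y) ∧ z
  ∧-assoc x y z = begin
    x ∧ (y ∧ z)              ≡⟨ K5 _ _ ⟩
    ¬ (¬ x ∨ ¬ (y ∧ z))      ≡⟨ cong (λ t → ¬ (¬ x ∨ t)) (¬-∧ y z) ⟩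
    ¬ (¬ x ∨ (¬ y ∨ ¬ z))    ≡⟨ cong ¬_ (K3 _ _ _) ⟩
    ¬ ((¬ x ∨ ¬ y) ∨ ¬ z)    ≡⟨ cong (λ t → ¬ (t ∨ ¬ z)) (sym (¬-∧ x y)) ⟩
    ¬ (¬ (x ∧ y) ∨ ¬ z)      ≡⟨ sym (K5 _ _) ⟩
    (x ∧ y) ∧ z              ∎

  ∧-identityʳ : ∀ x → x ∧ 𝟏 ≡ x
  ∧-identityʳ x = begin
    x ∧ 𝟏                    ≡⟨ K5 x 𝟏 ⟩
    ¬ (¬ x ∨ ¬ 𝟏)            ≡⟨ cong (λ t → ¬ (¬ x ∨ t)) ¬𝟏≡𝟎 ⟩
    ¬ (¬ x ∨ 𝟎)              ≡⟨ cong ¬_ (∨-identityʳ (¬ x)) ⟩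
    ¬ ¬ x                    ≡⟨ K4 x ⟩
    x                        ∎

  -- 𝟎 is not absorbing for ∧: this is the most that can be said.
  x∧𝟎≡x∧¬x : ∀ x → x ∧ 𝟎 ≡ x ∧ ¬ x
  x∧𝟎≡x∧¬x x = trans (sym (K6 x 𝟎)) (cong (x ∧_) (∨-identityʳ (¬ x)))

  ¬x∨y≡𝟏⇒x∧y≡x : ∀ {x y} → ¬ x ∨ y ≡ 𝟏 → x ∧ y ≡ x
  ¬x∨y≡𝟏⇒x∧y≡x {x} {y} ¬x∨y≡𝟏 = begin
    x ∧ y                    ≡⟨ sym (K6 x y) ⟩
    x ∧ (¬ x ∨ y)            ≡⟨ cong (x ∧_) ¬x∨y≡𝟏 ⟩
    x ∧ 𝟏                    ≡⟨ ∧-identityʳ x ⟩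
    x                        ∎

  x∨¬[x∨y]≡x∨¬y : ∀ x y → x ∨ ¬ (x ∨ y) ≡ x ∨ ¬ y
  x∨¬[x∨y]≡x∨¬y x y = begin
    x ∨ ¬ (x ∨ y)            ≡⟨ cong (λ t → t ∨ ¬ (t ∨ y)) (sym (K4 x)) ⟩
    ¬ ¬ x ∨ ¬ (¬ ¬ x ∨ y)    ≡⟨ sym (¬-∧ (¬ x) _) ⟩
    ¬ (¬ x ∧ (¬ ¬ x ∨ y))    ≡⟨ cong ¬_ (K6 (¬ x) y) ⟩
    ¬ (¬ x ∧ y)              ≡⟨ ¬-∧ (¬ x) y ⟩
    ¬ ¬ x ∨ ¬ y              ≡⟨ cong (_∨ ¬ y) (K4 x) ⟩
    x ∨ ¬ y                  ∎

  x∨[x∧¬x]≡x : ∀ x → x ∨ (x ∧ ¬ x) ≡ x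
  x∨[x∧¬x]≡x x = begin
    x ∨ (x ∧ ¬ x)            ≡⟨ cong (λ t → x ∨ (t ∧ ¬ x)) (sym (K4 x)) ⟩
    x ∨ (¬ ¬ x ∧ ¬ x)        ≡⟨ cong (x ∨_) (sym (¬-∨ (¬ x) x)) ⟩
    x ∨ ¬ (¬ x ∨ x)          ≡⟨ cong (λ t → x ∨ ¬ t) (K2 (¬ x) x) ⟩
    x ∨ ¬ (x ∨ ¬ x)          ≡⟨ x∨¬[x∨y]≡x∨¬y x (¬ x) ⟩
    x ∨ ¬ ¬ x                ≡⟨ cong (x ∨_) (K4 x) ⟩
    x ∨ x                    ≡⟨ K1 x ⟩
    x                        ∎

  complemented⇒¬x∧x≡𝟎 : ∀ {c} → c ∨ ¬ c ≡ 𝟏 → ¬ c ∧ c ≡ 𝟎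
  complemented⇒¬x∧x≡𝟎 {c} c∨¬c≡𝟏 = begin
    ¬ c ∧ c                  ≡⟨ cong (¬ c ∧_) (sym (K4 c)) ⟩
    ¬ c ∧ ¬ ¬ c              ≡⟨ sym (¬-∨ c (¬ c)) ⟩
    ¬ (c ∨ ¬ c)              ≡⟨ cong ¬_ c∨¬c≡𝟏 ⟩
    ¬ 𝟏                      ≡⟨ ¬𝟏≡𝟎 ⟩
    𝟎                        ∎

  complemented⇒𝟏∨x≡𝟏 : ∀ {c} → c ∨ ¬ c ≡ 𝟏 → 𝟏 ∨ c ≡ 𝟏
  complemented⇒𝟏∨x≡𝟏 {c} c∨¬c≡𝟏 = begin
    𝟏 ∨ c                    ≡⟨ cong (_∨ c) (sym c∨¬c≡𝟏) ⟩
    (c ∨ ¬ c) ∨ c            ≡⟨ K2 _ c ⟩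
    c ∨ (c ∨ ¬ c)            ≡⟨ K3 c c (¬ c) ⟩
    (c ∨ c) ∨ ¬ c            ≡⟨ cong (_∨ ¬ c) (K1 c) ⟩
    c ∨ ¬ c                  ≡⟨ c∨¬c≡𝟏 ⟩
    𝟏                        ∎

  x∨J₂x≡x : ∀ x → x ∨ J₂ x ≡ x
  x∨J₂x≡x x = sym (begin
    x                        ≡⟨ sym (∨-identityʳ x) ⟩
    x ∨ 𝟎                    ≡⟨ cong (x ∨_) (sym (K12 x)) ⟩
    x ∨ J₂ (x ∧ ¬ x)         ≡⟨ K10 x _ ⟩
    x ∨ J₂ (x ∨ (x ∧ ¬ x))   ≡⟨ cong (λ t → x ∨ J₂ t) (x∨[x∧¬x]≡x x) ⟩
    x ∨ J₂ x                 ∎)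

  x≡J₂x∨[x∧¬x] : ∀ x → x ≡ J₂ x ∨ (x ∧ ¬ x)
  x≡J₂x∨[x∧¬x] x = begin
    x                        ≡⟨ sym (x∨J₂x≡x x) ⟩
    x ∨ J₂ x                 ≡⟨ K2 x _ ⟩
    J₂ x ∨ x                 ≡⟨ cong (J₂ x ∨_) (sym (K4 x)) ⟩
    J₂ x ∨ ¬ ¬ x             ≡⟨ sym (x∨¬[x∨y]≡x∨¬y (J₂ x) (¬ x)) ⟩
    J₂ x ∨ ¬ (J₂ x ∨ ¬ x)    ≡⟨ cong (J₂ x ∨_) ¬[J₂x∨¬x]≡x∧¬x ⟩
    J₂ x ∨ (x ∧ ¬ x)         ∎
    where
    ¬[J₂x∨¬x]≡x∧¬x : ¬ (J₂ x ∨ ¬ x) ≡ x ∧ ¬ x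
    ¬[J₂x∨¬x]≡x∧¬x = begin
      ¬ (J₂ x ∨ ¬ x)         ≡⟨ trans (¬-∨ _ _) (cong (¬ J₂ x ∧_) (K4 x)) ⟩
      ¬ J₂ x ∧ x             ≡⟨ cong (¬ J₂ x ∧_) (trans (sym (K11 x)) (∧-comm x _)) ⟩
      ¬ J₂ x ∧ (J₂ x ∧ x)    ≡⟨ ∧-assoc _ _ _ ⟩
      (¬ J₂ x ∧ J₂ x) ∧ x    ≡⟨ cong (_∧ x) (complemented⇒¬x∧x≡𝟎 (K9 x)) ⟩
      𝟎 ∧ x                  ≡⟨ ∧-comm 𝟎 x ⟩
      x ∧ 𝟎                  ≡⟨ x∧𝟎≡x∧¬x x ⟩
      x ∧ ¬ x                ∎

  J₂-idem : ∀ x → J₂ (J₂ x) ≡ J₂ x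
  J₂-idem x = begin
    J₂ c                     ≡⟨ sym (¬x∨y≡𝟏⇒x∧y≡x ¬J₂c∨c≡𝟏) ⟩
    J₂ c ∧ c                 ≡⟨ ∧-comm _ c ⟩
    c ∧ J₂ c                 ≡⟨ K11 c ⟩
    c                        ∎
    where
    c = J₂ x
    ¬J₂c∨c≡𝟏 : ¬ J₂ c ∨ c ≡ 𝟏
    ¬J₂c∨c≡𝟏 = begin
      ¬ J₂ c ∨ c             ≡⟨ cong (¬ J₂ c ∨_) (sym (x∨J₂x≡x c)) ⟩
      ¬ J₂ c ∨ (c ∨ J₂ c)    ≡⟨ cong (¬ J₂ c ∨_) (K2 c _) ⟩
      ¬ J₂ c ∨ (J₂ c ∨ c)    ≡⟨ K3 _ _ _ ⟩
      (¬ J₂ c ∨ J₂ c) ∨ c    ≡⟨ cong (_∨ c) (trans (K2 _ _) (K9 c)) ⟩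
      𝟏 ∨ c                  ≡⟨ complemented⇒𝟏∨x≡𝟏 (K9 x) ⟩
      𝟏                      ∎

  x∨¬J₂y≡x∨¬J₂[x∨y] : ∀ x y → x ∨ ¬ (J₂ y) ≡ x ∨ ¬ (J₂ (x ∨ y))
  x∨¬J₂y≡x∨¬J₂[x∨y] x y = begin
    x ∨ ¬ J₂ y               ≡⟨ sym (x∨¬[x∨y]≡x∨¬y x _) ⟩
    x ∨ ¬ (x ∨ J₂ y)         ≡⟨ cong (λ t → x ∨ ¬ t) (K10 x y) ⟩
    x ∨ ¬ (x ∨ J₂ (x ∨ y))   ≡⟨ x∨¬[x∨y]≡x∨¬y x _ ⟩
    x ∨ ¬ J₂ (x ∨ y)         ∎

lemma4p2 : ∀ {a : Level} (A : KAlgebra a) → let open KAlgebra A in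
    (∀ x → x ∨ J₂ x ≡ x)
    × (∀ x → x ≡ J₂ x ∨ (x ∧ ¬ x))
    × (∀ x → J₂ (J₂ x) ≡ J₂ x)
    × (∀ x y → x ∨ ¬ (J₂ y) ≡ x ∨ ¬ (J₂ (x ∨ y)))
lemma4p2 A = x∨J₂x≡x , x≡J₂x∨[x∧¬x] , J₂-idem , x∨¬J₂y≡x∨¬J₂[x∨y]
  where open KAlgebraProperties A
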